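{- Let $G$ be a bipartite (multi)graph which is the union of $n$ matchings $M_1,\dots,M_n$, each with at least $2n$ edges. Then $G$ contains a rainbow matching with $n$ edges.
   Context: The matchings are regarded as colour classes (an edge of $M_i$ has colour $i$); the matchings need not be edge-disjoint. A matching is rainbow if its edges come from distinct matchings $M_i$ (have distinct colours). -}

module Defs where

open import Data.Nat using (ℕ; _≤_; _*_)
open import Data.Fin using (Fin)
open import Data.Product using (_×_; Σ; ∃-syntax; proj₁; proj₂)
open import Data.List using (List; length)
open import Data.List.Membership.Propositional using (_∈_)
open import Data.List.Relation.Unary.AllPairs using (AllPairs)
open import Relation.Binary.PropositionalEquality using (_≡_; _≢_)
open import Function.Definitions using (Injective)

-- Parallel edges never lie in a common
-- matching, so a matching is determined by its set of endpoint pairs.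
Edge : ℕ → ℕ → Set
Edge a b = Fin a × Fin b

Disjoint : ∀ {a b} → Edge a b → Edge a b → Set
Disjoint e f = (proj₁ e ≢ proj₁ f) × (proj₂ e ≢ proj₂ f)

IsMatching : ∀ {a b} → List (Edge a b) → Set
IsMatching = AllPairs Disjoint

RainbowMatching : ∀ {n a b} → (Fin n → List (Edge a b)) → ℕ → Set
RainbowMatching {n} {a} {b} M k =
  Σ (Fin k → Fin n) λ c → Σ (Fin k → Edge a b) λ e →
    Injective _≡_ _≡_ c
    × (∀ j → e j ∈ M (c j))
    × (∀ i j → i ≢ j → Disjoint (e i) (e j))

module Submission where

-- The key fact is that an edge g meets at most two edges
-- of a matching M (at most one at each endpoint), so deleting from M the edges
-- meeting g costs at most two edges and leaves a matching.  Iterating over a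
-- list L of edges: if 2·|L| < |M|, some edge of M is disjoint from every edge
-- of L (`disjoint-edge`).
--
-- Consequently any k matchings N₀,…,N_{k-1}, each with at least 2k edges,
-- admit pairwise disjoint representatives e_j ∈ N_j (`disjoint-representatives`):
-- choose representatives of N₁,…,N_{k-1} recursively, then pick an edge of N₀
-- avoiding these k-1 edges, which is possible since 2(k-1) < 2k ≤ |N₀|.

open import Defs
open import Data.Nat using (ℕ; zero; suc; _≤_; _<_; _*_; _+_; s≤s; z≤n; s≤s⁻¹)
open import Data.Nat.Properties using (≤-trans; ≤-reflexive; *-suc; *-monoʳ-≤; *-monoʳ-<; n≤1+n; n<1+n; <-≤-trans)
open import Data.Fin using (Fin; zero; suc)
open import Data.Fin.Properties using (_≟_)
open import Data.List using (List; []; _∷_; length; filter; tabulate)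
open import Data.List.Properties using (filter-all; length-tabulate)
open import Data.List.Membership.Propositional using (_∈_)
open import Data.List.Membership.Propositional.Properties using (∈-filter⁻; ∈-tabulate⁺)
open import Data.List.Relation.Unary.Any using (here)
open import Data.List.Relation.Unary.All as All using (All; []; _∷_)
open import Data.List.Relation.Unary.AllPairs as AllPairs using (AllPairs; []; _∷_)
open import Data.List.Relation.Unary.AllPairs.Properties using (filter⁺)
open import Data.Product using (_×_; _,_; proj₁; proj₂; ∃; Σ)
open import Relation.Nullary using (yes; no; ¬?; contradiction)
open import Relation.Binary.PropositionalEquality using (_≡_; _≢_; refl; sym; trans; cong; subst)

length-filter-≢ : ∀ {A : Set} {m} (p : A → Fin m) (x : Fin m) (xs : List A) →
                  AllPairs (λ u v → p u ≢ p v) xs →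
                  length xs ≤ suc (length (filter (λ u → ¬? (p u ≟ x)) xs))
length-filter-≢ p x [] [] = z≤n
length-filter-≢ p x (u ∷ xs) (u≢xs ∷ distinct) with p u ≟ x
... | no _ = s≤s (length-filter-≢ p x xs distinct)
... | yes pu≡x = s≤s (≤-reflexive (sym (cong length (filter-all _ rest-kept))))
  where
  rest-kept : All (λ v → p v ≢ x) xs
  rest-kept = All.map (λ pu≢pv pv≡x → pu≢pv (trans pu≡x (sym pv≡x))) u≢xs

module _ {a b : ℕ} where

  avoiding : Edge a b → List (Edge a b) → List (Edge a b)
  avoiding g M = filter (λ f → ¬? (proj₂ f ≟ proj₂ g))
                        (filter (λ f → ¬? (proj₁ f ≟ proj₁ g)) M)

  avoiding-sound : ∀ {g f} M → f ∈ avoiding g M → f ∈ M × Disjoint f g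
  avoiding-sound M f∈ =
    let (f∈₁ , right≢) = ∈-filter⁻ _ f∈
        (f∈M , left≢) = ∈-filter⁻ _ {xs = M} f∈₁
    in f∈M , left≢ , right≢

  avoiding-matching : ∀ g {M} → IsMatching M → IsMatching (avoiding g M)
  avoiding-matching g m = filter⁺ _ (filter⁺ _ m)

  avoiding-length : ∀ g {M} → IsMatching M → length M ≤ 2 + length (avoiding g M)
  avoiding-length g {M} m =
    ≤-trans (length-filter-≢ proj₁ (proj₁ g) M (AllPairs.map proj₁ m))
            (s≤s (length-filter-≢ proj₂ (proj₂ g) _ (AllPairs.map proj₂ (filter⁺ _ m))))

  disjoint-edge : ∀ (L M : List (Edge a b)) → IsMatching M → 2 * length L < length M →
                  ∃ λ f → f ∈ M × All (Disjoint f) L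
  disjoint-edge [] (f ∷ _) _ _ = f , here refl , []
  disjoint-edge (g ∷ L) M m large =
    let (f , f∈ , f-avoids-L) = disjoint-edge L (avoiding g M) (avoiding-matching g m) large'
        (f∈M , f-avoids-g) = avoiding-sound M f∈
    in f , f∈M , f-avoids-g ∷ f-avoids-L
    where
    large' : 2 * length L < length (avoiding g M)
    large' = s≤s⁻¹ (s≤s⁻¹ (≤-trans (subst (_< length M) (*-suc 2 (length L)) large)
                                    (avoiding-length g m)))

  disjoint-sym : ∀ {e f : Edge a b} → Disjoint e f → Disjoint f e
  disjoint-sym (left≢ , right≢) = (λ q → left≢ (sym q)) , (λ q → right≢ (sym q))

  disjoint-representatives : ∀ k (N : Fin k → List (Edge a b)) →
    (∀ j → IsMatching (N j)) → (∀ j → 2 * k ≤ length (N j)) →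
    Σ (Fin k → Edge a b) λ e → (∀ j → e j ∈ N j) × (∀ i j → i ≢ j → Disjoint (e i) (e j))
  disjoint-representatives zero N _ _ = (λ ()) , (λ ()) , (λ ())
  disjoint-representatives (suc k) N m large = e , e∈N , e-disjoint
    where
    rest = disjoint-representatives k (λ j → N (suc j)) (λ j → m (suc j))
             (λ j → ≤-trans (*-monoʳ-≤ 2 (n≤1+n k)) (large (suc j)))
    others : Fin k → Edge a b
    others = proj₁ rest

    fewer-others : 2 * length (tabulate others) < length (N zero)
    fewer-others = subst (λ l → 2 * l < length (N zero)) (sym (length-tabulate others))
                     (<-≤-trans (*-monoʳ-< 2 (n<1+n k)) (large zero))

    new = disjoint-edge (tabulate others) (N zero) (m zero) fewer-others
    new-avoids : ∀ j → Disjoint (proj₁ new) (others j)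
    new-avoids j = All.lookup (proj₂ (proj₂ new)) (∈-tabulate⁺ j)

    e : Fin (suc k) → Edge a b
    e zero = proj₁ new
    e (suc j) = others j

    e∈N : ∀ j → e j ∈ N j
    e∈N zero = proj₁ (proj₂ new)
    e∈N (suc j) = proj₁ (proj₂ rest) j

    e-disjoint : ∀ i j → i ≢ j → Disjoint (e i) (e j)
    e-disjoint zero zero i≢j = contradiction refl i≢j
    e-disjoint zero (suc j) _ = new-avoids j
    e-disjoint (suc i) zero _ = disjoint-sym (new-avoids i)
    e-disjoint (suc i) (suc j) i≢j = proj₂ (proj₂ rest) i j (λ q → i≢j (cong suc q))

lemma1p6 : (n a b : ℕ) (M : Fin n → List (Edge a b)) →
    (∀ i → IsMatching (M i)) →
    (∀ i → 2 * n ≤ length (M i)) →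
    RainbowMatching M n
lemma1p6 n a b M matchings large =
  let (e , e∈M , disjoint) = disjoint-representatives n M matchings large
  in (λ j → j) , e , (λ eq → eq) , e∈M , disjoint
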